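{- Let $m$ be a positive integer. Then each of the Diophantine equations \[ x^2=(2^{3m}+1)2^{n}+1-2^{3m+3}, \qquad x^2=\tfrac{1}{9}(2^{6m}-1)2^{n}+\tfrac{1}{9}(2^{6m+3}+1) \] has at least five solutions $(x,n)$ with $x$ a positive integer and $n$ a non-negative integer. More precisely, the following pairs $(x,n)$ are solutions of the first equation: \[ (3,3),\ (2^{2m+1}-2^{m+1}-1,\ m+2),\ (2^{3m+1}-1,\ 3m+2),\ (2^{3m+2}+1,\ 3m+4),\ (2^{6m+3}+2^{3m+2}-1,\ 9m+6), \] and the following pairs $(x,n)$ are solutions of the second equation: \[ (2^{3m},0),\ \Big(\tfrac{1}{3}(2^{4m+1}+2^{2m+1}-1),\ 2m+2\Big),\ \Big(\tfrac{1}{3}(2^{6m+1}+1),\ 6m+2\Big),\ \Big(\tfrac{1}{3}(2^{6m+2}-1),\ 6m+4\Big),\ \Big(\tfrac{1}{3}(2^{3(4m+1)}-2^{2(3m+1)}-1),\ 18m+6\Big). \] -}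

module Defs where

open import Data.Nat using (ℕ)
open import Data.Integer using (ℤ; +_; _+_; _-_; _*_; _^_; _<_)
open import Data.Product using (_×_)
open import Relation.Binary.PropositionalEquality using (_≡_)

Sol₁ : ℕ → ℤ → ℕ → Set
Sol₁ m x n = (+ 0 < x) ×
  (x ^ 2 ≡ ((+ 2) ^ (3 Data.Nat.* m) + + 1) * (+ 2) ^ n + + 1 - (+ 2) ^ (3 Data.Nat.* m Data.Nat.+ 3))

-- (x , n) solves  x² = (1/9)(2^{6m}-1) 2^n + (1/9)(2^{6m+3}+1),  x a positive integer, n ∈ ℕ;
-- equation multiplied through by 9 (equivalent over ℤ).
Sol₂ : ℕ → ℤ → ℕ → Set
Sol₂ m x n = (+ 0 < x) ×
  (+ 9 * x ^ 2 ≡ ((+ 2) ^ (6 Data.Nat.* m) - + 1) * (+ 2) ^ n + ((+ 2) ^ (6 Data.Nat.* m Data.Nat.+ 3) + + 1))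

-- Put t = 2^m and s = 2^(2m) = 4^m. Every power of 2 occurring in the first family is t^k 2^r,
-- and every power occurring in the second family (except 2^(3m) = t^3) is s^k 2^r, so each claimed
-- solution is a polynomial identity in t or s. The thirds are integers because s ≡ 1 (mod 3):
-- with s = 1 + 3d, each x of the second family is a polynomial in d with natural coefficients and
-- constant term 1. Likewise m ≥ 1 gives t = 2 + c, and each x of the first family is a polynomial
-- in c with natural coefficients and positive constant term, hence positive.
module Submission where

open import Defs
open import Data.Nat using (ℕ; NonZero)
open import Data.Integer using (ℤ; +_; _+_; _-_; _*_; _^_)
open import Data.Product using (_×_; ∃)
open import Relation.Binary.PropositionalEquality using (_≡_)

open import Data.Nat using (suc; zero; z<s)
import Data.Nat as ℕ
open import Data.Nat.Properties using (*-comm; *-assoc)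
open import Data.Nat.Tactic.RingSolver using (solve-∀)
open import Data.Integer using (_<_; +<+)
open import Data.Integer.Properties using (pos-*; *-zeroʳ; ^-*-assoc; ^-distribˡ-+-*)
open import Data.Integer.Solver using (module +-*-Solver)
open +-*-Solver using (solve; _:=_; con; _:+_; _:*_; _:-_; _:^_)
open import Data.List using (List; []; _∷_)
open import Data.Product using (_,_)
open import Relation.Binary.PropositionalEquality
  using (refl; sym; trans; cong; cong₂; module ≡-Reasoning)
open ≡-Reasoning

^[k*b]≡[^b]^k : ∀ (a : ℤ) k b → a ^ (k ℕ.* b) ≡ (a ^ b) ^ k
^[k*b]≡[^b]^k a k b = trans (cong (a ^_) (*-comm k b)) (sym (^-*-assoc a b k))

[1+a]^k≡1+a*d : ∀ a k → ∃ λ d → (+ suc a) ^ k ≡ + 1 + + a * + d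
[1+a]^k≡1+a*d a zero    = 0 , cong (λ y → + 1 + y) (sym (*-zeroʳ (+ a)))
[1+a]^k≡1+a*d a (suc k) with [1+a]^k≡1+a*d a k
... | d , eq = suc d ℕ.+ a ℕ.* d , (begin
  + suc a * (+ suc a) ^ k              ≡⟨ cong (λ y → + suc a * y) eq ⟩
  + suc a * (+ 1 + + a * + d)          ≡⟨ step (+ a) (+ d) ⟩
  + 1 + + a * (+ 1 + + d + + a * + d)  ≡⟨ cong (λ y → + 1 + + a * (+ 1 + + d + y)) (sym (pos-* a d)) ⟩
  + 1 + + a * + (suc d ℕ.+ a ℕ.* d)    ∎)
  where
  step : ∀ a d → (+ 1 + a) * (+ 1 + a * d) ≡ + 1 + a * (+ 1 + d + a * d)
  step = solve 2 (λ a d → (con (+ 1) :+ a) :* (con (+ 1) :+ a :* d) :=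
      con (+ 1) :+ a :* (con (+ 1) :+ d :+ a :* d)) refl

2^m≡2+c : ∀ m → .{{_ : NonZero m}} → ∃ λ c → (+ 2) ^ m ≡ + 2 + + c
2^m≡2+c (suc k) with [1+a]^k≡1+a*d 1 k
... | d , eq = 2 ℕ.* d , (begin
  + 2 * (+ 2) ^ k          ≡⟨ cong (λ y → + 2 * y) eq ⟩
  + 2 * (+ 1 + + 1 * + d)  ≡⟨ step (+ d) ⟩
  + 2 + + 2 * + d          ≡⟨ cong (λ y → + 2 + y) (sym (pos-* 2 d)) ⟩
  + 2 + + (2 ℕ.* d)        ∎)
  where
  step : ∀ d → + 2 * (+ 1 + + 1 * d) ≡ + 2 + + 2 * d
  step = solve 1 (λ d → con (+ 2) :* (con (+ 1) :+ con (+ 1) :* d) :=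
      con (+ 2) :+ con (+ 2) :* d) refl

4^m≡1+3d : ∀ m → ∃ λ d → (+ 2) ^ (2 ℕ.* m) ≡ + 1 + + 3 * + d
4^m≡1+3d m with [1+a]^k≡1+a*d 3 m
... | d , eq = d , trans (sym (^-*-assoc (+ 2) 2 m)) eq

horner : ℕ → List ℕ → ℤ → ℤ
horner a []       x = + a
horner a (b ∷ bs) x = + a + x * horner b bs x

horner-nonNeg : ∀ a bs c → ∃ λ n → horner a bs (+ c) ≡ + n
horner-nonNeg a []       c = a , refl
horner-nonNeg a (b ∷ bs) c with horner-nonNeg b bs c
... | n , eq = a ℕ.+ c ℕ.* n , cong (λ y → + a + y) (trans (cong (λ y → + c * y) eq) (sym (pos-* c n)))

horner-positive : ∀ a bs c .{{_ : NonZero a}} {x} → horner a bs (+ c) ≡ x → + 0 < x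
horner-positive (suc a) []       c refl = +<+ z<s
horner-positive (suc a) (b ∷ bs) c refl with horner-nonNeg b bs c
... | n , eq rewrite eq | sym (pos-* c n) = +<+ z<s

9*x²≡[3*x]² : ∀ x → + 9 * x ^ 2 ≡ (+ 3 * x) ^ 2
9*x²≡[3*x]² = solve 1 (λ x → con (+ 9) :* x :^ 2 := (con (+ 3) :* x) :^ 2) refl

mkSol₁ : ∀ m n {x X U T} → x ≡ X → (+ 2) ^ (3 ℕ.* m) ≡ U → (+ 2) ^ n ≡ T →
         + 0 < X → X ^ 2 ≡ (U + + 1) * T + + 1 - U * + 8 → Sol₁ m x n
mkSol₁ m n refl refl refl X>0 X² rewrite ^-distribˡ-+-* (+ 2) (3 ℕ.* m) 3 = X>0 , X²

mkSol₂ : ∀ m n {x X V T} → x ≡ X → (+ 2) ^ (6 ℕ.* m) ≡ V → (+ 2) ^ n ≡ T →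
         + 0 < X → + 9 * X ^ 2 ≡ (V - + 1) * T + (V * + 8 + + 1) → Sol₂ m x n
mkSol₂ m n refl refl refl X>0 9X² rewrite ^-distribˡ-+-* (+ 2) (6 ℕ.* m) 3 = X>0 , 9X²

mkSol₂-third : ∀ m n a bs d .{{_ : NonZero a}} {P P′ V T} →
               P ≡ P′ → + 3 * horner a bs (+ d) ≡ P′ →
               (+ 2) ^ (6 ℕ.* m) ≡ V → (+ 2) ^ n ≡ T → P′ ^ 2 ≡ (V - + 1) * T + (V * + 8 + + 1) →
               ∃ λ x → (+ 3 * x ≡ P) × Sol₂ m x n
mkSol₂-third m n a bs d refl 3x≡P V≡ T≡ P² =
  horner a bs (+ d) , 3x≡P ,
  mkSol₂ m n refl V≡ T≡ (horner-positive a bs d refl)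
    (trans (9*x²≡[3*x]² (horner a bs (+ d))) (trans (cong (_^ 2) 3x≡P) P²))

module Solutions (m c d : ℕ) (2^m≡t : (+ 2) ^ m ≡ + 2 + + c)
                 (4^m≡s : (+ 2) ^ (2 ℕ.* m) ≡ + 1 + + 3 * + d) where

  t s : ℤ
  t = + 2 + + c
  s = + 1 + + 3 * + d

  2^[k*m]≡t^k : ∀ k → (+ 2) ^ (k ℕ.* m) ≡ t ^ k
  2^[k*m]≡t^k k = trans (^[k*b]≡[^b]^k (+ 2) k m) (cong (_^ k) 2^m≡t)

  2^[k*m+r]≡t^k*2^r : ∀ k r → (+ 2) ^ (k ℕ.* m ℕ.+ r) ≡ t ^ k * (+ 2) ^ r
  2^[k*m+r]≡t^k*2^r k r = trans (^-distribˡ-+-* (+ 2) (k ℕ.* m) r) (cong (_* (+ 2) ^ r) (2^[k*m]≡t^k k))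

  2^[m+r]≡t*2^r : ∀ r → (+ 2) ^ (m ℕ.+ r) ≡ t * (+ 2) ^ r
  2^[m+r]≡t*2^r r = trans (^-distribˡ-+-* (+ 2) m r) (cong (_* (+ 2) ^ r) 2^m≡t)

  -- For a literal k, k ℕ.* 2 normalises to a literal, so these match the statement's 4 * m, 6 * m, 18 * m.
  2^[k*2*m]≡s^k : ∀ k → (+ 2) ^ (k ℕ.* 2 ℕ.* m) ≡ s ^ k
  2^[k*2*m]≡s^k k = begin
    (+ 2) ^ (k ℕ.* 2 ℕ.* m)    ≡⟨ cong ((+ 2) ^_) (*-assoc k 2 m) ⟩
    (+ 2) ^ (k ℕ.* (2 ℕ.* m))  ≡⟨ ^[k*b]≡[^b]^k (+ 2) k (2 ℕ.* m) ⟩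
    ((+ 2) ^ (2 ℕ.* m)) ^ k    ≡⟨ cong (_^ k) 4^m≡s ⟩
    s ^ k                      ∎

  2^[k*2*m+r]≡s^k*2^r : ∀ k r → (+ 2) ^ (k ℕ.* 2 ℕ.* m ℕ.+ r) ≡ s ^ k * (+ 2) ^ r
  2^[k*2*m+r]≡s^k*2^r k r =
    trans (^-distribˡ-+-* (+ 2) (k ℕ.* 2 ℕ.* m) r) (cong (_* (+ 2) ^ r) (2^[k*2*m]≡s^k k))

  2^[2*m+r]≡s*2^r : ∀ r → (+ 2) ^ (2 ℕ.* m ℕ.+ r) ≡ s * (+ 2) ^ r
  2^[2*m+r]≡s*2^r r = trans (^-distribˡ-+-* (+ 2) (2 ℕ.* m) r) (cong (_* (+ 2) ^ r) 4^m≡s)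

  sol₁-3 : Sol₁ m (+ 3) 3
  sol₁-3 = mkSol₁ m 3 refl (2^[k*m]≡t^k 3) refl (+<+ z<s) (identity t)
    where
    identity : ∀ t → (+ 3) ^ 2 ≡ (t ^ 3 + + 1) * + 8 + + 1 - t ^ 3 * + 8
    identity = solve 1 (λ t → con (+ 3) :^ 2 :=
      (t :^ 3 :+ con (+ 1)) :* con (+ 8) :+ con (+ 1) :- t :^ 3 :* con (+ 8)) refl

  sol₁-m+2 : Sol₁ m ((+ 2) ^ (2 ℕ.* m ℕ.+ 1) - (+ 2) ^ (m ℕ.+ 1) - + 1) (m ℕ.+ 2)
  sol₁-m+2 = mkSol₁ m (m ℕ.+ 2)
    (cong₂ (λ a b → a - b - + 1) (2^[k*m+r]≡t^k*2^r 2 1) (2^[m+r]≡t*2^r 1))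
    (2^[k*m]≡t^k 3) (2^[m+r]≡t*2^r 2)
    (horner-positive 3 (6 ∷ 2 ∷ []) c (expansion (+ c))) (identity t)
    where
    expansion : ∀ c → horner 3 (6 ∷ 2 ∷ []) c ≡ (+ 2 + c) ^ 2 * + 2 - (+ 2 + c) * + 2 - + 1
    expansion = solve 1 (λ c → con (+ 3) :+ c :* (con (+ 6) :+ c :* con (+ 2)) :=
      (con (+ 2) :+ c) :^ 2 :* con (+ 2) :- (con (+ 2) :+ c) :* con (+ 2) :- con (+ 1)) refl
    identity : ∀ t → (t ^ 2 * + 2 - t * + 2 - + 1) ^ 2 ≡ (t ^ 3 + + 1) * (t * + 4) + + 1 - t ^ 3 * + 8
    identity = solve 1 (λ t → (t :^ 2 :* con (+ 2) :- t :* con (+ 2) :- con (+ 1)) :^ 2 :=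
      (t :^ 3 :+ con (+ 1)) :* (t :* con (+ 4)) :+ con (+ 1) :- t :^ 3 :* con (+ 8)) refl

  sol₁-3m+2 : Sol₁ m ((+ 2) ^ (3 ℕ.* m ℕ.+ 1) - + 1) (3 ℕ.* m ℕ.+ 2)
  sol₁-3m+2 = mkSol₁ m (3 ℕ.* m ℕ.+ 2)
    (cong (_- + 1) (2^[k*m+r]≡t^k*2^r 3 1)) (2^[k*m]≡t^k 3) (2^[k*m+r]≡t^k*2^r 3 2)
    (horner-positive 15 (24 ∷ 12 ∷ 2 ∷ []) c (expansion (+ c))) (identity t)
    where
    expansion : ∀ c → horner 15 (24 ∷ 12 ∷ 2 ∷ []) c ≡ (+ 2 + c) ^ 3 * + 2 - + 1
    expansion = solve 1 (λ c → con (+ 15) :+ c :* (con (+ 24) :+ c :* (con (+ 12) :+ c :* con (+ 2))) :=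
      (con (+ 2) :+ c) :^ 3 :* con (+ 2) :- con (+ 1)) refl
    identity : ∀ t → (t ^ 3 * + 2 - + 1) ^ 2 ≡ (t ^ 3 + + 1) * (t ^ 3 * + 4) + + 1 - t ^ 3 * + 8
    identity = solve 1 (λ t → (t :^ 3 :* con (+ 2) :- con (+ 1)) :^ 2 :=
      (t :^ 3 :+ con (+ 1)) :* (t :^ 3 :* con (+ 4)) :+ con (+ 1) :- t :^ 3 :* con (+ 8)) refl

  sol₁-3m+4 : Sol₁ m ((+ 2) ^ (3 ℕ.* m ℕ.+ 2) + + 1) (3 ℕ.* m ℕ.+ 4)
  sol₁-3m+4 = mkSol₁ m (3 ℕ.* m ℕ.+ 4)
    (cong (_+ + 1) (2^[k*m+r]≡t^k*2^r 3 2)) (2^[k*m]≡t^k 3) (2^[k*m+r]≡t^k*2^r 3 4)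
    (horner-positive 33 (48 ∷ 24 ∷ 4 ∷ []) c (expansion (+ c))) (identity t)
    where
    expansion : ∀ c → horner 33 (48 ∷ 24 ∷ 4 ∷ []) c ≡ (+ 2 + c) ^ 3 * + 4 + + 1
    expansion = solve 1 (λ c → con (+ 33) :+ c :* (con (+ 48) :+ c :* (con (+ 24) :+ c :* con (+ 4))) :=
      (con (+ 2) :+ c) :^ 3 :* con (+ 4) :+ con (+ 1)) refl
    identity : ∀ t → (t ^ 3 * + 4 + + 1) ^ 2 ≡ (t ^ 3 + + 1) * (t ^ 3 * + 16) + + 1 - t ^ 3 * + 8
    identity = solve 1 (λ t → (t :^ 3 :* con (+ 4) :+ con (+ 1)) :^ 2 :=
      (t :^ 3 :+ con (+ 1)) :* (t :^ 3 :* con (+ 16)) :+ con (+ 1) :- t :^ 3 :* con (+ 8)) refl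

  sol₁-9m+6 : Sol₁ m ((+ 2) ^ (6 ℕ.* m ℕ.+ 3) + (+ 2) ^ (3 ℕ.* m ℕ.+ 2) - + 1) (9 ℕ.* m ℕ.+ 6)
  sol₁-9m+6 = mkSol₁ m (9 ℕ.* m ℕ.+ 6)
    (cong₂ (λ a b → a + b - + 1) (2^[k*m+r]≡t^k*2^r 6 3) (2^[k*m+r]≡t^k*2^r 3 2))
    (2^[k*m]≡t^k 3) (2^[k*m+r]≡t^k*2^r 9 6)
    (horner-positive 543 (1584 ∷ 1944 ∷ 1284 ∷ 480 ∷ 96 ∷ 8 ∷ []) c (expansion (+ c))) (identity t)
    where
    expansion : ∀ c → horner 543 (1584 ∷ 1944 ∷ 1284 ∷ 480 ∷ 96 ∷ 8 ∷ []) c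
                    ≡ (+ 2 + c) ^ 6 * + 8 + (+ 2 + c) ^ 3 * + 4 - + 1
    expansion = solve 1 (λ c →
      con (+ 543) :+ c :* (con (+ 1584) :+ c :* (con (+ 1944) :+ c :* (con (+ 1284) :+ c :* (con (+ 480) :+ c :*
        (con (+ 96) :+ c :* con (+ 8)))))) :=
      (con (+ 2) :+ c) :^ 6 :* con (+ 8) :+ (con (+ 2) :+ c) :^ 3 :* con (+ 4) :- con (+ 1)) refl
    identity : ∀ t → (t ^ 6 * + 8 + t ^ 3 * + 4 - + 1) ^ 2 ≡ (t ^ 3 + + 1) * (t ^ 9 * + 64) + + 1 - t ^ 3 * + 8
    identity = solve 1 (λ t → (t :^ 6 :* con (+ 8) :+ t :^ 3 :* con (+ 4) :- con (+ 1)) :^ 2 :=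
      (t :^ 3 :+ con (+ 1)) :* (t :^ 9 :* con (+ 64)) :+ con (+ 1) :- t :^ 3 :* con (+ 8)) refl

  sol₂-0 : Sol₂ m ((+ 2) ^ (3 ℕ.* m)) 0
  sol₂-0 = mkSol₂ m 0
    (2^[k*m]≡t^k 3) (2^[k*m]≡t^k 6) refl
    (horner-positive 8 (12 ∷ 6 ∷ 1 ∷ []) c (expansion (+ c))) (identity t)
    where
    expansion : ∀ c → horner 8 (12 ∷ 6 ∷ 1 ∷ []) c ≡ (+ 2 + c) ^ 3
    expansion = solve 1 (λ c → con (+ 8) :+ c :* (con (+ 12) :+ c :* (con (+ 6) :+ c :* con (+ 1))) :=
      (con (+ 2) :+ c) :^ 3) refl
    identity : ∀ t → + 9 * (t ^ 3) ^ 2 ≡ (t ^ 6 - + 1) * + 1 + (t ^ 6 * + 8 + + 1)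
    identity = solve 1 (λ t → con (+ 9) :* (t :^ 3) :^ 2 :=
      (t :^ 6 :- con (+ 1)) :* con (+ 1) :+ (t :^ 6 :* con (+ 8) :+ con (+ 1))) refl

  sol₂-2m+2 : ∃ λ x → (+ 3 * x ≡ (+ 2) ^ (4 ℕ.* m ℕ.+ 1) + (+ 2) ^ (2 ℕ.* m ℕ.+ 1) - + 1)
                    × Sol₂ m x (2 ℕ.* m ℕ.+ 2)
  sol₂-2m+2 = mkSol₂-third m (2 ℕ.* m ℕ.+ 2) 1 (6 ∷ 6 ∷ []) d
    (cong₂ (λ a b → a + b - + 1) (2^[k*2*m+r]≡s^k*2^r 2 1) (2^[2*m+r]≡s*2^r 1)) (thirds (+ d))
    (2^[k*2*m]≡s^k 3) (2^[2*m+r]≡s*2^r 2) (identity s)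
    where
    thirds : ∀ d → + 3 * horner 1 (6 ∷ 6 ∷ []) d ≡ (+ 1 + + 3 * d) ^ 2 * + 2 + (+ 1 + + 3 * d) * + 2 - + 1
    thirds = solve 1 (λ d → con (+ 3) :* (con (+ 1) :+ d :* (con (+ 6) :+ d :* con (+ 6))) :=
      (con (+ 1) :+ con (+ 3) :* d) :^ 2 :* con (+ 2) :+ (con (+ 1) :+ con (+ 3) :* d) :* con (+ 2) :- con (+ 1)) refl
    identity : ∀ s → (s ^ 2 * + 2 + s * + 2 - + 1) ^ 2 ≡ (s ^ 3 - + 1) * (s * + 4) + (s ^ 3 * + 8 + + 1)
    identity = solve 1 (λ s → (s :^ 2 :* con (+ 2) :+ s :* con (+ 2) :- con (+ 1)) :^ 2 :=
      (s :^ 3 :- con (+ 1)) :* (s :* con (+ 4)) :+ (s :^ 3 :* con (+ 8) :+ con (+ 1))) refl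

  sol₂-6m+2 : ∃ λ x → (+ 3 * x ≡ (+ 2) ^ (6 ℕ.* m ℕ.+ 1) + + 1) × Sol₂ m x (6 ℕ.* m ℕ.+ 2)
  sol₂-6m+2 = mkSol₂-third m (6 ℕ.* m ℕ.+ 2) 1 (6 ∷ 18 ∷ 18 ∷ []) d
    (cong (_+ + 1) (2^[k*2*m+r]≡s^k*2^r 3 1)) (thirds (+ d))
    (2^[k*2*m]≡s^k 3) (2^[k*2*m+r]≡s^k*2^r 3 2) (identity s)
    where
    thirds : ∀ d → + 3 * horner 1 (6 ∷ 18 ∷ 18 ∷ []) d ≡ (+ 1 + + 3 * d) ^ 3 * + 2 + + 1
    thirds = solve 1 (λ d → con (+ 3) :* (con (+ 1) :+ d :* (con (+ 6) :+ d :* (con (+ 18) :+ d :* con (+ 18)))) :=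
      (con (+ 1) :+ con (+ 3) :* d) :^ 3 :* con (+ 2) :+ con (+ 1)) refl
    identity : ∀ s → (s ^ 3 * + 2 + + 1) ^ 2 ≡ (s ^ 3 - + 1) * (s ^ 3 * + 4) + (s ^ 3 * + 8 + + 1)
    identity = solve 1 (λ s → (s :^ 3 :* con (+ 2) :+ con (+ 1)) :^ 2 :=
      (s :^ 3 :- con (+ 1)) :* (s :^ 3 :* con (+ 4)) :+ (s :^ 3 :* con (+ 8) :+ con (+ 1))) refl

  sol₂-6m+4 : ∃ λ x → (+ 3 * x ≡ (+ 2) ^ (6 ℕ.* m ℕ.+ 2) - + 1) × Sol₂ m x (6 ℕ.* m ℕ.+ 4)
  sol₂-6m+4 = mkSol₂-third m (6 ℕ.* m ℕ.+ 4) 1 (12 ∷ 36 ∷ 36 ∷ []) d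
    (cong (_- + 1) (2^[k*2*m+r]≡s^k*2^r 3 2)) (thirds (+ d))
    (2^[k*2*m]≡s^k 3) (2^[k*2*m+r]≡s^k*2^r 3 4) (identity s)
    where
    thirds : ∀ d → + 3 * horner 1 (12 ∷ 36 ∷ 36 ∷ []) d ≡ (+ 1 + + 3 * d) ^ 3 * + 4 - + 1
    thirds = solve 1 (λ d → con (+ 3) :* (con (+ 1) :+ d :* (con (+ 12) :+ d :* (con (+ 36) :+ d :* con (+ 36)))) :=
      (con (+ 1) :+ con (+ 3) :* d) :^ 3 :* con (+ 4) :- con (+ 1)) refl
    identity : ∀ s → (s ^ 3 * + 4 - + 1) ^ 2 ≡ (s ^ 3 - + 1) * (s ^ 3 * + 16) + (s ^ 3 * + 8 + + 1)
    identity = solve 1 (λ s → (s :^ 3 :* con (+ 4) :- con (+ 1)) :^ 2 :=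
      (s :^ 3 :- con (+ 1)) :* (s :^ 3 :* con (+ 16)) :+ (s :^ 3 :* con (+ 8) :+ con (+ 1))) refl

  sol₂-18m+6 : ∃ λ x → (+ 3 * x ≡ (+ 2) ^ (3 ℕ.* (4 ℕ.* m ℕ.+ 1)) - (+ 2) ^ (2 ℕ.* (3 ℕ.* m ℕ.+ 1)) - + 1)
                     × Sol₂ m x (18 ℕ.* m ℕ.+ 6)
  sol₂-18m+6 = mkSol₂-third m (18 ℕ.* m ℕ.+ 6) 1 (36 ∷ 324 ∷ 1404 ∷ 3240 ∷ 3888 ∷ 1944 ∷ []) d
    (cong₂ (λ a b → a - b - + 1)
      (trans (cong ((+ 2) ^_) (12m+3 m)) (2^[k*2*m+r]≡s^k*2^r 6 3))
      (trans (cong ((+ 2) ^_) (6m+2 m)) (2^[k*2*m+r]≡s^k*2^r 3 2)))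
    (thirds (+ d)) (2^[k*2*m]≡s^k 3) (2^[k*2*m+r]≡s^k*2^r 9 6) (identity s)
    where
    12m+3 : ∀ m → 3 ℕ.* (4 ℕ.* m ℕ.+ 1) ≡ 6 ℕ.* 2 ℕ.* m ℕ.+ 3
    12m+3 = solve-∀
    6m+2 : ∀ m → 2 ℕ.* (3 ℕ.* m ℕ.+ 1) ≡ 3 ℕ.* 2 ℕ.* m ℕ.+ 2
    6m+2 = solve-∀
    thirds : ∀ d → + 3 * horner 1 (36 ∷ 324 ∷ 1404 ∷ 3240 ∷ 3888 ∷ 1944 ∷ []) d
                 ≡ (+ 1 + + 3 * d) ^ 6 * + 8 - (+ 1 + + 3 * d) ^ 3 * + 4 - + 1
    thirds = solve 1 (λ d →
      con (+ 3) :* (con (+ 1) :+ d :* (con (+ 36) :+ d :* (con (+ 324) :+ d :* (con (+ 1404) :+ d :*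
        (con (+ 3240) :+ d :* (con (+ 3888) :+ d :* con (+ 1944))))))) :=
      (con (+ 1) :+ con (+ 3) :* d) :^ 6 :* con (+ 8) :- (con (+ 1) :+ con (+ 3) :* d) :^ 3 :* con (+ 4) :- con (+ 1)) refl
    identity : ∀ s → (s ^ 6 * + 8 - s ^ 3 * + 4 - + 1) ^ 2 ≡ (s ^ 3 - + 1) * (s ^ 9 * + 64) + (s ^ 3 * + 8 + + 1)
    identity = solve 1 (λ s → (s :^ 6 :* con (+ 8) :- s :^ 3 :* con (+ 4) :- con (+ 1)) :^ 2 :=
      (s :^ 3 :- con (+ 1)) :* (s :^ 9 :* con (+ 64)) :+ (s :^ 3 :* con (+ 8) :+ con (+ 1))) refl

theorem2p3 : (m : ℕ) → .{{_ : NonZero m}} →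
    (Sol₁ m (+ 3) 3
      × Sol₁ m ((+ 2) ^ (2 Data.Nat.* m Data.Nat.+ 1) - (+ 2) ^ (m Data.Nat.+ 1) - + 1) (m Data.Nat.+ 2)
      × Sol₁ m ((+ 2) ^ (3 Data.Nat.* m Data.Nat.+ 1) - + 1) (3 Data.Nat.* m Data.Nat.+ 2)
      × Sol₁ m ((+ 2) ^ (3 Data.Nat.* m Data.Nat.+ 2) + + 1) (3 Data.Nat.* m Data.Nat.+ 4)
      × Sol₁ m ((+ 2) ^ (6 Data.Nat.* m Data.Nat.+ 3) + (+ 2) ^ (3 Data.Nat.* m Data.Nat.+ 2) - + 1) (9 Data.Nat.* m Data.Nat.+ 6))
    × (Sol₂ m ((+ 2) ^ (3 Data.Nat.* m)) 0
      × ∃ (λ x → (+ 3 * x ≡ (+ 2) ^ (4 Data.Nat.* m Data.Nat.+ 1) + (+ 2) ^ (2 Data.Nat.* m Data.Nat.+ 1) - + 1) × Sol₂ m x (2 Data.Nat.* m Data.Nat.+ 2))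
      × ∃ (λ x → (+ 3 * x ≡ (+ 2) ^ (6 Data.Nat.* m Data.Nat.+ 1) + + 1) × Sol₂ m x (6 Data.Nat.* m Data.Nat.+ 2))
      × ∃ (λ x → (+ 3 * x ≡ (+ 2) ^ (6 Data.Nat.* m Data.Nat.+ 2) - + 1) × Sol₂ m x (6 Data.Nat.* m Data.Nat.+ 4))
      × ∃ (λ x → (+ 3 * x ≡ (+ 2) ^ (3 Data.Nat.* (4 Data.Nat.* m Data.Nat.+ 1)) - (+ 2) ^ (2 Data.Nat.* (3 Data.Nat.* m Data.Nat.+ 1)) - + 1) × Sol₂ m x (18 Data.Nat.* m Data.Nat.+ 6)))
theorem2p3 m with 2^m≡2+c m | 4^m≡1+3d m
... | c , 2^m≡t | d , 4^m≡s =
    (sol₁-3 , sol₁-m+2 , sol₁-3m+2 , sol₁-3m+4 , sol₁-9m+6) ,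
    (sol₂-0 , sol₂-2m+2 , sol₂-6m+2 , sol₂-6m+4 , sol₂-18m+6)
  where open Solutions m c d 2^m≡t 4^m≡s
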